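{- Let $k, m, c$ be positive integers with $1 \leq \lfloor k/2 \rfloor \leq c < k-1$ and $c \leq m$. Then there exists a $c$-uniform $(n, cn, k, m)$-CBC with $n = (k-c-1)\,A(m, 2(k-c-1), c)$; explicitly, one may take $\mathcal{X}$ to consist of $k-c-1$ copies of each member of a family of $c$-subsets of an $m$-set $\mathcal{S}$ whose pairwise symmetric differences all have size at least $2(k-c-1)$ and which has the maximum possible size $A(m, 2(k-c-1), c)$.
   Context: An $(n, N, k, m)$-CBC is a pair $(\mathcal{S}, \mathcal{X})$ where $\mathcal{S}$ is a set of $m$ elements and $\mathcal{X} = (X_1, \ldots, X_n)$ is a list (repetitions allowed) of $n$ subsets of $\mathcal{S}$ with $\sum_{j=1}^n |X_j| = N$, such that for every choice of $r$ distinct indices $i_1, \ldots, i_r$ with $1 \leq r \leq k$ one has $|X_{i_1} \cup \cdots \cup X_{i_r}| \geq r$. It is $c$-uniform if every $X_j$ has exactly $c$ elements (so $N = cn$). $A(m, 2d, w)$ denotes the maximum number of codewords in a binary constant weight code of length $m$, weight $w$ and minimum Hamming distance $2d$, i.e., the maximum size of a family of $w$-subsets of an $m$-set any two of which have symmetric difference of size at least $2d$. -}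

module Defs where

open import Data.Nat using (ℕ; _+_; _*_; _≤_)
open import Data.Fin using (Fin)
open import Data.Fin.Subset using (Subset; _∪_; _─_; ⋃; ∣_∣; _∈_)
open import Data.Fin.Subset.Properties using (_∈?_)
open import Data.List using (List; length; lookup; map; filter; allFin; concatMap; replicate)
open import Data.List.Relation.Unary.All using (All)
open import Data.List.Relation.Unary.AllPairs using (AllPairs)
open import Data.Product using (Σ; _×_)
open import Data.Nat.ListAction using (sum)
open import Relation.Binary.PropositionalEquality using (_≡_)

symDiff : ∀ {m} → Subset m → Subset m → ℕ
symDiff p q = ∣ (p ─ q) ∪ (q ─ p) ∣

-- A binary constant weight code of length m, weight w, min distance 2d:
-- a family (list) of w-subsets of Fin m, any two (distinct positions) of which
-- have symmetric difference of size at least 2d.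
IsCWCode : (m d w : ℕ) → List (Subset m) → Set
IsCWCode m d w F = All (λ x → ∣ x ∣ ≡ w) F × AllPairs (λ x y → 2 * d ≤ symDiff x y) F

IsMaxCWCode : (m d w : ℕ) → List (Subset m) → Set
IsMaxCWCode m d w F = IsCWCode m d w F × (∀ (G : List (Subset m)) → IsCWCode m d w G → length G ≤ length F)

-- A(m,2d,w) = a
IsA : (m d w a : ℕ) → Set
IsA m d w a = Σ (List (Subset m)) (λ F → IsMaxCWCode m d w F × length F ≡ a)

unionOver : ∀ {m} (X : List (Subset m)) → Subset (length X) → Subset m
unionOver X I = ⋃ (map (lookup X) (filter (_∈? I) (allFin (length X))))

IsCBC : (n N k m : ℕ) → List (Subset m) → Set
IsCBC n N k m X =
  length X ≡ n × sum (map ∣_∣ X) ≡ N ×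
  (∀ (I : Subset (length X)) → 1 ≤ ∣ I ∣ → ∣ I ∣ ≤ k → ∣ I ∣ ≤ ∣ unionOver X I ∣)

IsUniform : ∀ {m} (c : ℕ) → List (Subset m) → Set
IsUniform c X = All (λ x → ∣ x ∣ ≡ c) X

copies : ∀ {m} (t : ℕ) → List (Subset m) → List (Subset m)
copies t F = concatMap (replicate t) F

-- Put t = k - c - 1, so that k = c + t + 1 and 1 ≤ t ≤ c, and let X consist of t copies of each
-- codeword. Distinct members A ≠ B of X satisfy 2 |A ∪ B| = |A| + |B| + |A Δ B| ≥ 2 (c + t), and no set
-- occurs more than t times. Take r ≤ k members of X with union U. If |U| > c + t we are done. If
-- |U| < c + t, all r members coincide, so r ≤ t ≤ c ≤ |U|. If |U| = c + t, each member misses exactly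
-- t points of U, while the members missing a given point of U coincide, so at most t of them miss it;
-- counting pairs (member, missed point) gives r t ≤ t |U|.

module Submission where

open import Defs
open import Data.Bool using (true; false)
open import Data.Nat using (ℕ; zero; suc; _+_; _*_; _∸_; _≤_; _<_; z≤n; s≤s; z<s; NonZero; >-nonZero; >-nonZero⁻¹)
open import Data.Nat.DivMod using (_/_; _%_; m≡m%n+[m/n]*n; m%n<n)
open import Data.Nat.ListAction using (sum)
open import Data.Nat.Properties
open import Data.Nat.Tactic.RingSolver using (solve-∀)
open import Algebra.Properties.CommutativeSemigroup +-commutativeSemigroup using (x∙yz≈y∙xz)
open import Data.Fin using (Fin; zero; suc)
import Data.Fin as Fin
open import Data.Fin.Subset using (Subset; _∈_; _⊆_; _∪_; _─_; ⋃; ∣_∣; inside; outside)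
open import Data.Fin.Subset.Properties using (_∈?_; p⊆p∪q; q⊆p∪q; x∈p∪q⁻; drop-∷-⊆; drop-there; ∪-comm; p⊂q⇒∣p∣<∣q∣; p⊆q⇒∣p∣≤∣q∣)
import Data.Bool.Properties as Bool
open import Data.Vec using ([]; _∷_; tail)
import Data.Vec.Base as Vec
open import Data.Vec.Properties using (≡-dec)
open import Data.List using (List; []; _∷_; length; map; filter; lookup; allFin; tabulate; replicate; _++_)
open import Data.List.Properties using (filter-all; filter-≐; filter-none; filter-++; length-map; map-tabulate; tabulate-lookup; length-replicate; length-++; length-filter)
open import Data.List.Membership.Propositional using () renaming (_∈_ to _∈ₗ_)
open import Data.List.Membership.Propositional.Properties using (∈-filter⁻)
open import Data.List.Relation.Unary.Any using (here; there)
open import Data.List.Relation.Unary.All using (All; []; _∷_)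
import Data.List.Relation.Unary.All as All
import Data.List.Relation.Unary.All.Properties as AllP
open import Data.List.Relation.Unary.AllPairs using (AllPairs; []; _∷_)
import Data.List.Relation.Unary.AllPairs as AllPairs
open import Data.List.Relation.Binary.Sublist.Propositional using () renaming (_⊆_ to _⊑_)
open import Data.List.Relation.Binary.Sublist.Propositional.Properties using (All-resp-⊆; Any-resp-⊆; filter-⊆; filter⁺; length-mono-≤; map⁺)
open import Data.Product using (Σ; _×_; _,_)
open import Data.Sum using ([_,_])
open import Function using (_∘_; id)
open import Relation.Binary using (Symmetric; DecidableEquality; tri<; tri≈; tri>)
open import Relation.Nullary using (¬?; does; yes; no; contradiction)
open import Relation.Nullary.Decidable using (decidable-stable)
open import Relation.Unary using (Pred; Decidable)
open import Relation.Binary.PropositionalEquality using (_≡_; _≢_; ≢-sym; refl; sym; trans; cong; cong₂; subst; module ≡-Reasoning)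

private variable
  m n : ℕ
  p q r : Subset m

filter-map : ∀ {a b ℓ} {A : Set a} {B : Set b} {P : Pred B ℓ} (P? : Decidable P) (f : A → B) (xs : List A) →
             filter P? (map f xs) ≡ map f (filter (P? ∘ f) xs)
filter-map P? f []       = refl
filter-map P? f (x ∷ xs) with does (P? (f x))
... | true  = cong (f x ∷_) (filter-map P? f xs)
... | false = filter-map P? f xs

sum-map-const : ∀ {a} {A : Set a} {f : A → ℕ} {k} {xs : List A} → All (λ x → f x ≡ k) xs → sum (map f xs) ≡ length xs * k
sum-map-const []           = refl
sum-map-const (fx≡k ∷ all) = cong₂ _+_ fx≡k (sum-map-const all)

AllPairs-lookup : ∀ {a r} {A : Set a} {R : A → A → Set r} {xs : List A} {x y} → Symmetric R →
                  AllPairs R xs → x ∈ₗ xs → y ∈ₗ xs → x ≢ y → R x y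
AllPairs-lookup sym-R (_    ∷ _)    (here refl) (here refl) x≢y = contradiction refl x≢y
AllPairs-lookup sym-R (R[x] ∷ _)    (here refl) (there y∈)  _   = All.lookup R[x] y∈
AllPairs-lookup sym-R (R[y] ∷ _)    (there x∈)  (here refl) _   = sym-R (All.lookup R[y] x∈)
AllPairs-lookup sym-R (_    ∷ pairs) (there x∈) (there y∈)  x≢y = AllPairs-lookup sym-R pairs x∈ y∈ x≢y

⊆⋃ : ∀ {A} {L : List (Subset m)} → A ∈ₗ L → A ⊆ ⋃ L
⊆⋃ {L = B ∷ L} (here refl) = p⊆p∪q (⋃ L)
⊆⋃ {L = B ∷ L} (there A∈L) = q⊆p∪q B (⋃ L) ∘ ⊆⋃ A∈L

∪-least : p ⊆ r → q ⊆ r → p ∪ q ⊆ r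
∪-least {p = p} {q = q} p⊆r q⊆r x∈p∪q = [ p⊆r , q⊆r ] (x∈p∪q⁻ p q x∈p∪q)

∣q─p∣+∣p∣≡∣q∣ : p ⊆ q → ∣ q ─ p ∣ + ∣ p ∣ ≡ ∣ q ∣
∣q─p∣+∣p∣≡∣q∣ {p = []}          {[]}          _   = refl
∣q─p∣+∣p∣≡∣q∣ {p = outside ∷ p} {outside ∷ q} p⊆q = ∣q─p∣+∣p∣≡∣q∣ (drop-∷-⊆ p⊆q)
∣q─p∣+∣p∣≡∣q∣ {p = outside ∷ p} {inside  ∷ q} p⊆q = cong suc (∣q─p∣+∣p∣≡∣q∣ (drop-∷-⊆ p⊆q))
∣q─p∣+∣p∣≡∣q∣ {p = inside  ∷ p} {outside ∷ q} p⊆q with () ← p⊆q Vec.here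
∣q─p∣+∣p∣≡∣q∣ {p = inside  ∷ p} {inside  ∷ q} p⊆q =
  trans (+-suc _ _) (cong suc (∣q─p∣+∣p∣≡∣q∣ (drop-∷-⊆ p⊆q)))

symDiff-comm : (p q : Subset m) → symDiff p q ≡ symDiff q p
symDiff-comm p q = cong ∣_∣ (∪-comm (p ─ q) (q ─ p))

symDiff-self : (p : Subset m) → symDiff p p ≡ 0
symDiff-self []            = refl
symDiff-self (inside  ∷ p) = symDiff-self p
symDiff-self (outside ∷ p) = symDiff-self p

private
  double-suc : ∀ {x n} → x + x ≡ n → suc x + suc x ≡ suc (suc n)
  double-suc {x} e = cong suc (trans (+-suc x x) (cong suc e))

∣p∪q∣+∣p∪q∣≡∣p∣+∣q∣+symDiff : (p q : Subset m) → ∣ p ∪ q ∣ + ∣ p ∪ q ∣ ≡ ∣ p ∣ + ∣ q ∣ + symDiff p q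
∣p∪q∣+∣p∪q∣≡∣p∣+∣q∣+symDiff []            []            = refl
∣p∪q∣+∣p∪q∣≡∣p∣+∣q∣+symDiff (outside ∷ p) (outside ∷ q) = ∣p∪q∣+∣p∪q∣≡∣p∣+∣q∣+symDiff p q
∣p∪q∣+∣p∪q∣≡∣p∣+∣q∣+symDiff (inside  ∷ p) (inside  ∷ q) =
  trans (double-suc (∣p∪q∣+∣p∪q∣≡∣p∣+∣q∣+symDiff p q)) (cong (λ n → suc (n + symDiff p q)) (sym (+-suc ∣ p ∣ ∣ q ∣)))
∣p∪q∣+∣p∪q∣≡∣p∣+∣q∣+symDiff (inside  ∷ p) (outside ∷ q) =
  trans (double-suc (∣p∪q∣+∣p∪q∣≡∣p∣+∣q∣+symDiff p q)) (cong suc (sym (+-suc (∣ p ∣ + ∣ q ∣) (symDiff p q))))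
∣p∪q∣+∣p∪q∣≡∣p∣+∣q∣+symDiff (outside ∷ p) (inside  ∷ q) =
  trans (double-suc (∣p∪q∣+∣p∪q∣≡∣p∣+∣q∣+symDiff p q)) (begin
    suc (suc (∣ p ∣ + ∣ q ∣ + symDiff p q)) ≡⟨ cong (λ n → suc (n + symDiff p q)) (sym (+-suc ∣ p ∣ ∣ q ∣)) ⟩
    suc (∣ p ∣ + suc ∣ q ∣ + symDiff p q)   ≡⟨ sym (+-suc (∣ p ∣ + suc ∣ q ∣) (symDiff p q)) ⟩
    ∣ p ∣ + suc ∣ q ∣ + suc (symDiff p q)   ∎)
  where open ≡-Reasoning

c+t≤∣p∪q∣ : ∀ {c t} → ∣ p ∣ ≡ c → ∣ q ∣ ≡ c → 2 * t ≤ symDiff p q → c + t ≤ ∣ p ∪ q ∣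
c+t≤∣p∪q∣ {p = p} {q = q} {c} {t} ∣p∣≡c ∣q∣≡c 2t≤Δ = halve (begin
  (c + t) + (c + t)           ≡⟨ shuffle c t ⟩
  c + c + 2 * t               ≤⟨ +-monoʳ-≤ (c + c) 2t≤Δ ⟩
  c + c + symDiff p q         ≡⟨ cong₂ (λ a b → a + b + symDiff p q) (sym ∣p∣≡c) (sym ∣q∣≡c) ⟩
  ∣ p ∣ + ∣ q ∣ + symDiff p q ≡⟨ sym (∣p∪q∣+∣p∪q∣≡∣p∣+∣q∣+symDiff p q) ⟩
  ∣ p ∪ q ∣ + ∣ p ∪ q ∣       ∎)
  where
  open ≤-Reasoning
  shuffle : ∀ c t → (c + t) + (c + t) ≡ c + c + 2 * t
  shuffle = solve-∀
  halve : ∀ {a b} → a + a ≤ b + b → a ≤ b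
  halve a+a≤b+b = ≮⇒≥ (λ b<a → <⇒≱ (+-mono-< b<a b<a) a+a≤b+b)

_≟ˢ_ : DecidableEquality (Subset m)
_≟ˢ_ = ≡-dec Bool._≟_

multiplicity : Subset m → List (Subset m) → ℕ
multiplicity A = length ∘ filter (_≟ˢ A)

multiplicity-++ : ∀ A (xs ys : List (Subset m)) → multiplicity A (xs ++ ys) ≡ multiplicity A xs + multiplicity A ys
multiplicity-++ A xs ys = trans (cong length (filter-++ (_≟ˢ A) xs ys)) (length-++ (filter (_≟ˢ A) xs))

multiplicity-absent : ∀ {A} {xs : List (Subset m)} → All (_≢ A) xs → multiplicity A xs ≡ 0
multiplicity-absent {A = A} = cong length ∘ filter-none (_≟ˢ A)

length≤multiplicity-bound : ∀ {t} (L : List (Subset m)) → (∀ A → multiplicity A L ≤ t) →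
                            (∀ {A B} → A ∈ₗ L → B ∈ₗ L → A ≡ B) → length L ≤ t
length≤multiplicity-bound []      _    _       = z≤n
length≤multiplicity-bound (A ∷ L) mult≤t all-eq =
  subst (_≤ _) (cong length (filter-all (_≟ˢ A) (All.tabulate (λ B∈ → all-eq B∈ (here refl))))) (mult≤t A)

missing : Fin m → List (Subset m) → ℕ
missing i = length ∘ filter (λ A → ¬? (i ∈? A))

missing-tail : (i : Fin m) (L : List (Subset (suc m))) → missing i (map tail L) ≡ missing (suc i) L
missing-tail i []            = refl
missing-tail i ((_ ∷ A) ∷ L) with does (i ∈? A)
... | true  = missing-tail i L
... | false = cong suc (missing-tail i L)

-- The heads of the members are split only so that _─_, which matches on its second argument, computes.
private
  sum-∣outside∷U─∣ : (U : Subset m) (L : List (Subset (suc m))) →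
                     sum (map (λ A → ∣ (outside ∷ U) ─ A ∣) L) ≡ sum (map (λ A → ∣ U ─ A ∣) (map tail L))
  sum-∣outside∷U─∣ U []            = refl
  sum-∣outside∷U─∣ U ((inside  ∷ A) ∷ L) = cong (∣ U ─ A ∣ +_) (sum-∣outside∷U─∣ U L)
  sum-∣outside∷U─∣ U ((outside ∷ A) ∷ L) = cong (∣ U ─ A ∣ +_) (sum-∣outside∷U─∣ U L)

  sum-∣inside∷U─∣ : (U : Subset m) (L : List (Subset (suc m))) →
                    sum (map (λ A → ∣ (inside ∷ U) ─ A ∣) L) ≡ missing zero L + sum (map (λ A → ∣ U ─ A ∣) (map tail L))
  sum-∣inside∷U─∣ U []                 = refl
  sum-∣inside∷U─∣ U ((inside  ∷ A) ∷ L) =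
    trans (cong (∣ U ─ A ∣ +_) (sum-∣inside∷U─∣ U L)) (x∙yz≈y∙xz ∣ U ─ A ∣ (missing zero L) _)
  sum-∣inside∷U─∣ U ((outside ∷ A) ∷ L) =
    cong suc (trans (cong (∣ U ─ A ∣ +_) (sum-∣inside∷U─∣ U L)) (x∙yz≈y∙xz ∣ U ─ A ∣ (missing zero L) _))

sum-∣U─A∣≤ : ∀ s (U : Subset m) (L : List (Subset m)) →
             (∀ {i} → i ∈ U → missing i L ≤ s) → sum (map (λ A → ∣ U ─ A ∣) L) ≤ s * ∣ U ∣
sum-∣U─A∣≤ s []            []       _ = z≤n
sum-∣U─A∣≤ s []            ([] ∷ L) _ = sum-∣U─A∣≤ s [] L λ ()
sum-∣U─A∣≤ s (outside ∷ U) L missing≤s = begin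
  sum (map (λ A → ∣ (outside ∷ U) ─ A ∣) L)    ≡⟨ sum-∣outside∷U─∣ U L ⟩
  sum (map (λ A → ∣ U ─ A ∣) (map tail L))     ≤⟨ sum-∣U─A∣≤ s U (map tail L) missing≤s-tail ⟩
  s * ∣ U ∣                                    ∎
  where open ≤-Reasoning
        missing≤s-tail : ∀ {i} → i ∈ U → missing i (map tail L) ≤ s
        missing≤s-tail {i} i∈U = subst (_≤ s) (sym (missing-tail i L)) (missing≤s (Vec.there i∈U))
sum-∣U─A∣≤ s (inside ∷ U) L missing≤s = begin
  sum (map (λ A → ∣ (inside ∷ U) ─ A ∣) L)                 ≡⟨ sum-∣inside∷U─∣ U L ⟩
  missing zero L + sum (map (λ A → ∣ U ─ A ∣) (map tail L)) ≤⟨ +-mono-≤ (missing≤s Vec.here) (sum-∣U─A∣≤ s U (map tail L) missing≤s-tail) ⟩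
  s + s * ∣ U ∣                                            ≡⟨ sym (*-suc s ∣ U ∣) ⟩
  s * suc ∣ U ∣                                            ∎
  where open ≤-Reasoning
        missing≤s-tail : ∀ {i} → i ∈ U → missing i (map tail L) ≤ s
        missing≤s-tail {i} i∈U = subst (_≤ s) (sym (missing-tail i L)) (missing≤s (Vec.there i∈U))

record Spread (c t : ℕ) (L : List (Subset m)) : Set where
  field
    uniform       : All (λ A → ∣ A ∣ ≡ c) L
    far-apart     : ∀ {A B} → A ∈ₗ L → B ∈ₗ L → A ≢ B → c + t ≤ ∣ A ∪ B ∣
    multiplicity≤ : ∀ A → multiplicity A L ≤ t

Spread-⊑ : ∀ {c t} {L M : List (Subset m)} → L ⊑ M → Spread c t M → Spread c t L
Spread-⊑ L⊑M S = record
  { uniform       = All-resp-⊆ L⊑M uniform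
  ; far-apart     = λ A∈ B∈ → far-apart (Any-resp-⊆ L⊑M A∈) (Any-resp-⊆ L⊑M B∈)
  ; multiplicity≤ = λ A → ≤-trans (length-mono-≤ (filter⁺ (_≟ˢ A) (_≟ˢ A) (λ { refl → id }) L⊑M)) (multiplicity≤ A)
  }
  where open Spread S

length≤t : ∀ {c t} {L : List (Subset m)} → Spread c t L →
           (∀ {A B} → A ∈ₗ L → B ∈ₗ L → ∣ A ∪ B ∣ < c + t) → length L ≤ t
length≤t {L = L} S small = length≤multiplicity-bound L multiplicity≤ λ A∈ B∈ →
  decidable-stable (_ ≟ˢ _) λ A≢B → <⇒≱ (small A∈ B∈) (far-apart A∈ B∈ A≢B)
  where open Spread S

length-filter≤t : ∀ {c t ℓ} {L : List (Subset m)} {P : Pred (Subset m) ℓ} (P? : Decidable P) → Spread c t L →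
                  (∀ {A B} → A ∈ₗ L → B ∈ₗ L → P A → P B → ∣ A ∪ B ∣ < c + t) → length (filter P? L) ≤ t
length-filter≤t {L = L} P? S small = length≤t (Spread-⊑ (filter-⊆ P? L) S) λ A∈ B∈ →
  let A∈L , PA = ∈-filter⁻ P? A∈ ; B∈L , PB = ∈-filter⁻ P? B∈ in small A∈L B∈L PA PB

length≤∣⋃∣-if-∣⋃∣≡c+t : ∀ {c t} ⦃ _ : NonZero t ⦄ {L : List (Subset m)} → Spread c t L →
                   ∣ ⋃ L ∣ ≡ c + t → length L ≤ ∣ ⋃ L ∣
length≤∣⋃∣-if-∣⋃∣≡c+t {c = c} {t} {L} S ∣U∣≡c+t = *-cancelʳ-≤ (length L) ∣ U ∣ t (begin
  length L * t                   ≡⟨ sum-map-const (All.tabulate ∣U─A∣≡t) ⟨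
  sum (map (λ A → ∣ U ─ A ∣) L)   ≤⟨ sum-∣U─A∣≤ t U L missing≤t ⟩
  t * ∣ U ∣                      ≡⟨ *-comm t ∣ U ∣ ⟩
  ∣ U ∣ * t                      ∎)
  where
  open ≤-Reasoning
  U = ⋃ L
  ∣U─A∣≡t : ∀ {A} → A ∈ₗ L → ∣ U ─ A ∣ ≡ t
  ∣U─A∣≡t {A} A∈ = +-cancelʳ-≡ c _ _ (begin-equality
    ∣ U ─ A ∣ + c      ≡⟨ cong (∣ U ─ A ∣ +_) (All.lookup (Spread.uniform S) A∈) ⟨
    ∣ U ─ A ∣ + ∣ A ∣  ≡⟨ ∣q─p∣+∣p∣≡∣q∣ (⊆⋃ A∈) ⟩
    ∣ U ∣              ≡⟨ ∣U∣≡c+t ⟩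
    c + t              ≡⟨ +-comm c t ⟩
    t + c              ∎)
  -- the members missing a point i of U have a union avoiding i, hence strictly smaller than U
  missing≤t : ∀ {i} → i ∈ U → missing i L ≤ t
  missing≤t {i} i∈U = length-filter≤t (λ A → ¬? (i ∈? A)) S λ {A} {B} A∈ B∈ i∉A i∉B →
    subst (∣ A ∪ B ∣ <_) ∣U∣≡c+t
      (p⊂q⇒∣p∣<∣q∣ (∪-least (⊆⋃ A∈) (⊆⋃ B∈) , i , i∈U , [ i∉A , i∉B ] ∘ x∈p∪q⁻ A B))

length≤∣⋃∣ : ∀ {c t} ⦃ _ : NonZero t ⦄ {L : List (Subset m)} → t ≤ c → Spread c t L →
             length L ≤ suc (c + t) → length L ≤ ∣ ⋃ L ∣
length≤∣⋃∣ {L = []} _ _ _ = z≤n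
length≤∣⋃∣ {c = c} {t} {L@(A ∷ _)} t≤c S length≤1+c+t with <-cmp ∣ ⋃ L ∣ (c + t)
... | tri> _ _ c+t<∣U∣ = ≤-trans length≤1+c+t c+t<∣U∣
... | tri≈ _ ∣U∣≡c+t _ = length≤∣⋃∣-if-∣⋃∣≡c+t S ∣U∣≡c+t
... | tri< ∣U∣<c+t _ _ = begin
  length L  ≤⟨ length≤t S (λ A∈ B∈ → ≤-<-trans (p⊆q⇒∣p∣≤∣q∣ (∪-least (⊆⋃ A∈) (⊆⋃ B∈))) ∣U∣<c+t) ⟩
  t         ≤⟨ t≤c ⟩
  c         ≡⟨ All.lookup (Spread.uniform S) (here refl) ⟨
  ∣ A ∣     ≤⟨ p⊆q⇒∣p∣≤∣q∣ (⊆⋃ {L = L} (here refl)) ⟩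
  ∣ ⋃ L ∣   ∎
  where open ≤-Reasoning

-- unionOver X I is definitionally ⋃ (selected X I).
selected : (X : List (Subset m)) → Subset (length X) → List (Subset m)
selected X I = map (lookup X) (filter (_∈? I) (allFin (length X)))

selected-⊑ : (X : List (Subset m)) (I : Subset (length X)) → selected X I ⊑ X
selected-⊑ X I = subst (selected X I ⊑_) X≡ (map⁺ (lookup X) (filter-⊆ (_∈? I) (allFin (length X))))
  where X≡ = trans (map-tabulate id (lookup X)) (tabulate-lookup X)

length-filter-∈?-allFin : (I : Subset n) → length (filter (_∈? I) (allFin n)) ≡ ∣ I ∣
length-filter-∈?-tabulate-suc : ∀ s (I : Subset n) → length (filter (_∈? (s ∷ I)) (tabulate Fin.suc)) ≡ ∣ I ∣

length-filter-∈?-allFin []            = refl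
length-filter-∈?-allFin (inside  ∷ I) = cong suc (length-filter-∈?-tabulate-suc inside I)
length-filter-∈?-allFin (outside ∷ I) = length-filter-∈?-tabulate-suc outside I

length-filter-∈?-tabulate-suc {n} s I = begin
  length (filter (_∈? (s ∷ I)) (tabulate Fin.suc))               ≡⟨ cong (length ∘ filter (_∈? (s ∷ I))) (map-tabulate id Fin.suc) ⟨
  length (filter (_∈? (s ∷ I)) (map Fin.suc (allFin n)))         ≡⟨ cong length (filter-map (_∈? (s ∷ I)) Fin.suc (allFin n)) ⟩
  length (map Fin.suc (filter (λ i → Fin.suc i ∈? (s ∷ I)) (allFin n))) ≡⟨ length-map Fin.suc (filter (λ i → Fin.suc i ∈? (s ∷ I)) (allFin n)) ⟩
  length (filter (λ i → Fin.suc i ∈? (s ∷ I)) (allFin n))       ≡⟨ cong length (filter-≐ (λ i → Fin.suc i ∈? (s ∷ I)) (_∈? I) (drop-there , Vec.there) (allFin n)) ⟩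
  length (filter (_∈? I) (allFin n))                             ≡⟨ length-filter-∈?-allFin I ⟩
  ∣ I ∣                                                          ∎
  where open ≡-Reasoning

length-selected : (X : List (Subset m)) (I : Subset (length X)) → length (selected X I) ≡ ∣ I ∣
length-selected X I = trans (length-map (lookup X) (filter (_∈? I) (allFin (length X)))) (length-filter-∈?-allFin I)

Spread⇒IsCBC : ∀ {c t} ⦃ _ : NonZero t ⦄ {X : List (Subset m)} → t ≤ c → Spread c t X →
               IsCBC (length X) (c * length X) (suc (c + t)) m X
Spread⇒IsCBC {c = c} {X = X} t≤c S =
  refl , trans (sum-map-const (Spread.uniform S)) (*-comm (length X) c) , λ I _ ∣I∣≤k →
    let length≡ = length-selected X I in
    subst (_≤ ∣ unionOver X I ∣) length≡
      (length≤∣⋃∣ t≤c (Spread-⊑ (selected-⊑ X I) S) (subst (_≤ _) (sym length≡) ∣I∣≤k))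

All-copies : ∀ {ℓ} {P : Pred (Subset m) ℓ} t {F : List (Subset m)} → All P F → All P (copies t F)
All-copies t = AllP.concat⁺ ∘ AllP.map⁺ ∘ All.map (AllP.replicate⁺ t)

∈-copies⁻ : ∀ t {A} {F : List (Subset m)} → A ∈ₗ copies t F → A ∈ₗ F
∈-copies⁻ t = All.lookup (All-copies t (All.tabulate id))

length-copies : ∀ t (F : List (Subset m)) → length (copies t F) ≡ t * length F
length-copies t []      = sym (*-zeroʳ t)
length-copies t (B ∷ F) = begin
  length (replicate t B ++ copies t F)          ≡⟨ length-++ (replicate t B) ⟩
  length (replicate t B) + length (copies t F)  ≡⟨ cong₂ _+_ (length-replicate t) (length-copies t F) ⟩
  t + t * length F                              ≡⟨ *-suc t (length F) ⟨
  t * suc (length F)                            ∎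
  where open ≡-Reasoning

multiplicity-copies : ∀ t A {F : List (Subset m)} → AllPairs _≢_ F → multiplicity A (copies t F) ≤ t
multiplicity-copies t A []                           = z≤n
multiplicity-copies t A {F = B ∷ F} (B≢F ∷ distinct) with B ≟ˢ A
... | yes refl = begin
  multiplicity B (replicate t B ++ copies t F)                 ≡⟨ multiplicity-++ B (replicate t B) (copies t F) ⟩
  multiplicity B (replicate t B) + multiplicity B (copies t F) ≡⟨ cong (_ +_) (multiplicity-absent (All-copies t (All.map ≢-sym B≢F))) ⟩
  multiplicity B (replicate t B) + 0                           ≡⟨ +-identityʳ _ ⟩
  multiplicity B (replicate t B)                               ≤⟨ length-filter (_≟ˢ B) (replicate t B) ⟩
  length (replicate t B)                                       ≡⟨ length-replicate t ⟩
  t                                                            ∎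
  where open ≤-Reasoning
... | no B≢A = begin
  multiplicity A (replicate t B ++ copies t F)                 ≡⟨ multiplicity-++ A (replicate t B) (copies t F) ⟩
  multiplicity A (replicate t B) + multiplicity A (copies t F) ≡⟨ cong (_+ _) (multiplicity-absent (AllP.replicate⁺ t B≢A)) ⟩
  multiplicity A (copies t F)                                  ≤⟨ multiplicity-copies t A distinct ⟩
  t                                                            ∎
  where open ≤-Reasoning

≢-if-2t≤symDiff : ∀ {t} ⦃ _ : NonZero t ⦄ {p q : Subset m} → 2 * t ≤ symDiff p q → p ≢ q
≢-if-2t≤symDiff {t = t} {p} 2t≤Δ refl = <⇒≱ (*-monoʳ-< 2 (>-nonZero⁻¹ t)) (subst (2 * t ≤_) (symDiff-self p) 2t≤Δ)

copies-Spread : ∀ {c t} ⦃ _ : NonZero t ⦄ {F : List (Subset m)} → IsCWCode m t c F → Spread c t (copies t F)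
copies-Spread {c = c} {t = t} {F = F} (weight≡c , far) = record
  { uniform       = All-copies t weight≡c
  ; far-apart     = λ {A} {B} A∈ B∈ A≢B →
      c+t≤∣p∪q∣ {p = A} {q = B} (weight A∈) (weight B∈)
        (AllPairs-lookup (λ {p q} → subst (2 * t ≤_) (symDiff-comm p q)) far (∈-copies⁻ t A∈) (∈-copies⁻ t B∈) A≢B)
  ; multiplicity≤ = λ A → multiplicity-copies t A (AllPairs.map ≢-if-2t≤symDiff far)
  }
  where
  weight : ∀ {A} → A ∈ₗ copies t F → ∣ A ∣ ≡ c
  weight A∈ = All.lookup weight≡c (∈-copies⁻ t A∈)

copies-IsUniform×IsCBC : ∀ {c t} ⦃ _ : NonZero t ⦄ {F : List (Subset m)} → t ≤ c → IsCWCode m t c F →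
                         IsUniform c (copies t F) × IsCBC (t * length F) (c * (t * length F)) (suc (c + t)) m (copies t F)
copies-IsUniform×IsCBC {m} {c} {t} {F} t≤c code =
  Spread.uniform S , subst (λ n → IsCBC n (c * n) (suc (c + t)) m (copies t F)) (length-copies t F) (Spread⇒IsCBC t≤c S)
  where S = copies-Spread code

k≡suc[c+[k∸c∸1]] : ∀ k c → c < k ∸ 1 → k ≡ suc (c + (k ∸ c ∸ 1))
k≡suc[c+[k∸c∸1]] (suc (suc k)) zero    _          = refl
k≡suc[c+[k∸c∸1]] (suc (suc k)) (suc c) (s≤s c<k) = cong suc (k≡suc[c+[k∸c∸1]] (suc k) c c<k)

0<k∸c∸1 : ∀ k c → c < k ∸ 1 → 0 < k ∸ c ∸ 1
0<k∸c∸1 (suc (suc k)) zero    _          = z<s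
0<k∸c∸1 (suc (suc k)) (suc c) (s≤s c<k) = 0<k∸c∸1 (suc k) c c<k

k∸c∸1≤c : ∀ k c → k / 2 ≤ c → c < k ∸ 1 → k ∸ c ∸ 1 ≤ c
k∸c∸1≤c k c k/2≤c c<k∸1 = +-cancelˡ-≤ c _ _ (≤-pred (begin
  suc (c + (k ∸ c ∸ 1)) ≡⟨ k≡suc[c+[k∸c∸1]] k c c<k∸1 ⟨
  k                     ≡⟨ m≡m%n+[m/n]*n k 2 ⟩
  k % 2 + k / 2 * 2     ≤⟨ +-mono-≤ (≤-pred (m%n<n k 2)) (*-monoˡ-≤ 2 k/2≤c) ⟩
  1 + c * 2             ≡⟨ cong suc (*-comm c 2) ⟩
  suc (c + (c + 0))     ≡⟨ cong (λ n → suc (c + n)) (+-identityʳ c) ⟩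
  suc (c + c)           ∎))
  where open ≤-Reasoning

mainTheorem7 : (k m c : ℕ) → 1 ≤ k → 1 ≤ m → 1 ≤ c →
    1 ≤ k / 2 → k / 2 ≤ c → c < k ∸ 1 → c ≤ m →
    ((a : ℕ) → IsA m (k ∸ c ∸ 1) c a →
      Σ (List (Subset m)) (λ X → IsUniform c X × IsCBC ((k ∸ c ∸ 1) * a) (c * ((k ∸ c ∸ 1) * a)) k m X))
    × ((F : List (Subset m)) → IsMaxCWCode m (k ∸ c ∸ 1) c F →
      IsUniform c (copies (k ∸ c ∸ 1) F)
      × IsCBC ((k ∸ c ∸ 1) * length F) (c * ((k ∸ c ∸ 1) * length F)) k m (copies (k ∸ c ∸ 1) F))
mainTheorem7 k m c _ _ _ _ k/2≤c c<k∸1 _ = fromA , fromCode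
  where
  t = k ∸ c ∸ 1
  instance
    t-nonZero : NonZero t
    t-nonZero = >-nonZero (0<k∸c∸1 k c c<k∸1)
  fromCode : (F : List (Subset m)) → IsMaxCWCode m t c F →
             IsUniform c (copies t F) × IsCBC (t * length F) (c * (t * length F)) k m (copies t F)
  fromCode F (code , _) = subst (λ k → IsUniform c (copies t F) × IsCBC (t * length F) (c * (t * length F)) k m (copies t F))
    (sym (k≡suc[c+[k∸c∸1]] k c c<k∸1)) (copies-IsUniform×IsCBC (k∸c∸1≤c k c k/2≤c c<k∸1) code)
  fromA : (a : ℕ) → IsA m t c a → Σ (List (Subset m)) (λ X → IsUniform c X × IsCBC (t * a) (c * (t * a)) k m X)
  fromA _ (F , maximum , refl) = copies t F , fromCode F maximum
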